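{- Let $n$ be a positive integer and let $\mathcal{P} \subseteq \left(\tfrac{1}{2}\mathbb{Z}\right)^n$ be a set such that for all distinct $\mathbf{p}, \mathbf{q} \in \mathcal{P}$, $\|\mathbf{p}-\mathbf{q}\|_1 = \sum_{i=1}^n |p_i - q_i|$ is an odd integer. Then $|\mathcal{P}| \leq 2^n$.
   Context: $\tfrac{1}{2}\mathbb{Z} = \{k/2 : k \in \mathbb{Z}\}$. -}

module Defs where

open import Data.Nat using (ℕ; _+_; _*_)
open import Data.Integer as ℤ using (ℤ; ∣_∣; _-_)
open import Data.Vec using (Vec; zipWith; foldr)
open import Data.Product using (∃)
open import Relation.Binary.PropositionalEquality using (_≡_)

-- A half-integer x ∈ ½ℤ is represented by the integer 2x (a bijection ½ℤ ≃ ℤ).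
record HalfInt : Set where
  constructor half
  field
    twice : ℤ
open HalfInt public

Point : ℕ → Set
Point n = Vec HalfInt n

twiceL1 : ∀ {n} → Point n → Point n → ℕ
twiceL1 p q = foldr _ _+_ 0 (zipWith (λ a b → ∣ twice a - twice b ∣) p q)

L1Odd : ∀ {n} → Point n → Point n → Set
L1Odd p q = ∃ λ k → twiceL1 p q ≡ 2 * (2 * k + 1)

-- Encode a point p by the integer vector 2p.  Then ‖p − q‖₁ odd means
-- Σ |2pᵢ − 2qᵢ| ≡ 2 (mod 4).  Since |d| ≡ d (mod 2), and |d| ≡ d (mod 4) when d is even,
-- two points whose coordinates agree mod 2 have distance ≡ S p − S q (mod 4), where S is
-- the coordinate sum.  Label a point by the parities of its last n − 1 coordinates and
-- the bit ⌊S/2⌋ mod 2; there are 2ⁿ labels.  For two points with the same label the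
-- distance is even, which forces the first coordinates to agree mod 2 as well; then the
-- label bit forces S p ≡ S q (mod 4), so the distance is ≡ 0 (mod 4), not 2.
module Submission where

open import Defs
open import Data.Nat using (ℕ; suc; _≤_; _^_)
import Data.Nat as ℕ
import Data.Nat.Divisibility as ℕ
open import Data.Integer using (ℤ; +_; -_; ∣_∣; _+_; _*_; _-_; 0ℤ; _%ℕ_; _/ℕ_)
open import Data.Integer.DivMod using (n%ℕd<d; a≡a%ℕn+[a/ℕn]*n)
open import Data.Integer.Divisibility.Signed
  using (_∣_; divides; ∣⇒∣ᵤ; ∣-refl; ∣-trans; ∣m∣n⇒∣m+n; ∣m∣n⇒∣m-n; ∣m+n∣n⇒∣m; ∣m⇒∣-m; ∣n⇒∣m*n; *-monoʳ-∣; *-monoˡ-∣)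
open import Data.Integer.Properties using (+∣i∣≡i⊎+∣i∣≡-i; +-inverseʳ; *-identityʳ; pos-+; pos-*)
open import Data.Integer.Tactic.RingSolver using (solve-∀)
open import Data.Fin using (Fin; zero; fromℕ<; combine; _≟_)
open import Data.Fin.Properties using (fromℕ<-injective; combine-injectiveˡ; combine-injectiveʳ; injective⇒≤)
open import Data.Vec using ([]; _∷_)
open import Data.Vec.Relation.Binary.Pointwise.Inductive using (Pointwise; []; _∷_)
open import Data.Product using (_,_)
open import Data.Sum using (inj₁; inj₂)
open import Data.Empty using (⊥-elim)
open import Function.Definitions using (Injective)
open import Relation.Binary.PropositionalEquality using (_≡_; refl; sym; cong; cong₂; subst; module ≡-Reasoning)
open import Relation.Nullary using (¬_; yes; no)

infix 4 _≡_mod_ _≋_mod_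

_≡_mod_ : ℤ → ℤ → ℤ → Set
_≡_mod_ a b k = k ∣ a - b

_≋_mod_ : ∀ {n} → Point n → Point n → ℤ → Set
_≋_mod_ p q k = Pointwise (λ x y → twice x ≡ twice y mod k) p q

twiceSum : ∀ {n} → Point n → ℤ
twiceSum []       = 0ℤ
twiceSum (x ∷ xs) = twice x + twiceSum xs

%ℕ-≡⇒-≡/ℕ-* : ∀ a b d .{{_ : ℕ.NonZero d}} → a %ℕ d ≡ b %ℕ d → a - b ≡ (a /ℕ d - b /ℕ d) * + d
%ℕ-≡⇒-≡/ℕ-* a b d r≡s = begin
  a - b                                          ≡⟨ cong₂ _-_ (a≡a%ℕn+[a/ℕn]*n a d) (a≡a%ℕn+[a/ℕn]*n b d) ⟩
  (+ r + qa * + d) - (+ (b %ℕ d) + qb * + d)     ≡⟨ cong (λ s → (+ r + qa * + d) - (+ s + qb * + d)) (sym r≡s) ⟩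
  (+ r + qa * + d) - (+ r + qb * + d)            ≡⟨ shift-cancel (+ r) qa qb (+ d) ⟩
  (qa - qb) * + d                                ∎
  where
  open ≡-Reasoning
  r = a %ℕ d
  qa = a /ℕ d
  qb = b /ℕ d
  shift-cancel : ∀ r x y d → (r + x * d) - (r + y * d) ≡ (x - y) * d
  shift-cancel = solve-∀

%ℕ-≡⇒≡-mod : ∀ a b d .{{_ : ℕ.NonZero d}} → a %ℕ d ≡ b %ℕ d → a ≡ b mod + d
%ℕ-≡⇒≡-mod a b d r≡s = divides (a /ℕ d - b /ℕ d) (%ℕ-≡⇒-≡/ℕ-* a b d r≡s)

2∣r-s⇒r≡s : ∀ {r s} → r ℕ.< 2 → s ℕ.< 2 → + 2 ∣ + r - + s → r ≡ s
2∣r-s⇒r≡s {0} {0} _ _ _ = refl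
2∣r-s⇒r≡s {1} {1} _ _ _ = refl
2∣r-s⇒r≡s {0} {1} _ _ 2∣-1 with () ← ℕ.∣1⇒≡1 (∣⇒∣ᵤ 2∣-1)
2∣r-s⇒r≡s {1} {0} _ _ 2∣1 with () ← ℕ.∣1⇒≡1 (∣⇒∣ᵤ 2∣1)
2∣r-s⇒r≡s {suc (suc _)} (ℕ.s≤s (ℕ.s≤s ())) _ _
2∣r-s⇒r≡s {_} {suc (suc _)} _ (ℕ.s≤s (ℕ.s≤s ())) _

≡-mod2⇒%ℕ2-≡ : ∀ a b → a ≡ b mod + 2 → a %ℕ 2 ≡ b %ℕ 2
≡-mod2⇒%ℕ2-≡ a b 2∣a-b =
  2∣r-s⇒r≡s (n%ℕd<d a 2) (n%ℕd<d b 2) (∣m+n∣n⇒∣m (subst (+ 2 ∣_) split 2∣a-b) (∣n⇒∣m*n (qa - qb) ∣-refl))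
  where
  open ≡-Reasoning
  r = a %ℕ 2
  s = b %ℕ 2
  qa = a /ℕ 2
  qb = b /ℕ 2
  regroup : ∀ r s x y → (r + x * + 2) - (s + y * + 2) ≡ (r - s) + (x - y) * + 2
  regroup = solve-∀
  split : a - b ≡ (+ r - + s) + (qa - qb) * + 2
  split = begin
    a - b                                    ≡⟨ cong₂ _-_ (a≡a%ℕn+[a/ℕn]*n a 2) (a≡a%ℕn+[a/ℕn]*n b 2) ⟩
    (+ r + qa * + 2) - (+ s + qb * + 2)      ≡⟨ regroup (+ r) (+ s) qa qb ⟩
    (+ r - + s) + (qa - qb) * + 2            ∎

≡-mod2∧halves⇒≡-mod4 : ∀ a b → a ≡ b mod + 2 → a /ℕ 2 ≡ b /ℕ 2 mod + 2 → a ≡ b mod + 4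
≡-mod2∧halves⇒≡-mod4 a b a≡b halves =
  subst (+ 4 ∣_) (sym (%ℕ-≡⇒-≡/ℕ-* a b 2 (≡-mod2⇒%ℕ2-≡ a b a≡b))) (*-monoˡ-∣ (+ 2) halves)

≡-mod-+-cancelʳ : ∀ {k} a b {s t} → a + s ≡ b + t mod k → s ≡ t mod k → a ≡ b mod k
≡-mod-+-cancelʳ {k} a b {s} {t} a+s≡b+t s≡t = subst (k ∣_) (regroup a b s t) (∣m∣n⇒∣m-n a+s≡b+t s≡t)
  where
  regroup : ∀ a b s t → ((a + s) - (b + t)) - (s - t) ≡ a - b
  regroup = solve-∀

k∣i⇒2k∣∣i∣-i : ∀ {k i} → k ∣ i → + 2 * k ∣ + ∣ i ∣ - i
k∣i⇒2k∣∣i∣-i {k} {i} k∣i with +∣i∣≡i⊎+∣i∣≡-i i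
... | inj₁ ∣i∣≡i  rewrite ∣i∣≡i  = divides 0ℤ (+-inverseʳ i)
... | inj₂ ∣i∣≡-i rewrite ∣i∣≡-i = subst (+ 2 * k ∣_) (neg-double i) (∣m⇒∣-m (*-monoʳ-∣ (+ 2) k∣i))
  where
  neg-double : ∀ i → - (+ 2 * i) ≡ - i - i
  neg-double = solve-∀

≋-mod1 : ∀ {n} (p q : Point n) → p ≋ q mod + 1
≋-mod1 []       []       = []
≋-mod1 (x ∷ xs) (y ∷ ys) = divides (twice x - twice y) (sym (*-identityʳ _)) ∷ ≋-mod1 xs ys

≋⇒twiceSum-≡ : ∀ {n k} {p q : Point n} → p ≋ q mod k → twiceSum p ≡ twiceSum q mod k
≋⇒twiceSum-≡ []                          = divides 0ℤ refl
≋⇒twiceSum-≡ {p = x ∷ xs} {y ∷ ys} (h ∷ hs) =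
  subst (_ ∣_) (sym (regroup (twice x) (twice y) (twiceSum xs) (twiceSum ys))) (∣m∣n⇒∣m+n h (≋⇒twiceSum-≡ hs))
  where
  regroup : ∀ a b s t → (a + s) - (b + t) ≡ (a - b) + (s - t)
  regroup = solve-∀

≋⇒twiceL1-≡ : ∀ {n k} {p q : Point n} → p ≋ q mod k → + twiceL1 p q ≡ twiceSum p - twiceSum q mod + 2 * k
≋⇒twiceL1-≡ []                          = divides 0ℤ refl
≋⇒twiceL1-≡ {p = x ∷ xs} {y ∷ ys} (h ∷ hs) =
  subst (_ ∣_) (sym eq) (∣m∣n⇒∣m+n (k∣i⇒2k∣∣i∣-i h) (≋⇒twiceL1-≡ hs))
  where
  open ≡-Reasoning
  d = twice x - twice y
  regroup : ∀ e l a b s t → (e + l) - ((a + s) - (b + t)) ≡ (e - (a - b)) + (l - (s - t))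
  regroup = solve-∀
  eq : + twiceL1 (x ∷ xs) (y ∷ ys) - (twiceSum (x ∷ xs) - twiceSum (y ∷ ys))
     ≡ (+ ∣ d ∣ - d) + (+ twiceL1 xs ys - (twiceSum xs - twiceSum ys))
  eq = begin
    + (∣ d ∣ ℕ.+ twiceL1 xs ys) - (twiceSum (x ∷ xs) - twiceSum (y ∷ ys))
      ≡⟨ cong (_- (twiceSum (x ∷ xs) - twiceSum (y ∷ ys))) (pos-+ ∣ d ∣ (twiceL1 xs ys)) ⟩
    (+ ∣ d ∣ + + twiceL1 xs ys) - (twiceSum (x ∷ xs) - twiceSum (y ∷ ys))
      ≡⟨ regroup (+ ∣ d ∣) (+ twiceL1 xs ys) (twice x) (twice y) (twiceSum xs) (twiceSum ys) ⟩
    (+ ∣ d ∣ - d) + (+ twiceL1 xs ys - (twiceSum xs - twiceSum ys))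
      ∎

L1Odd⇒twiceL1≡2-mod4 : ∀ {n} (p q : Point n) → L1Odd p q → + twiceL1 p q ≡ + 2 mod + 4
L1Odd⇒twiceL1≡2-mod4 p q (c , eq) = divides (+ c) (begin
  + twiceL1 p q - + 2                ≡⟨ cong (λ l → + l - + 2) eq ⟩
  + (2 ℕ.* (2 ℕ.* c ℕ.+ 1)) - + 2    ≡⟨ cong (_- + 2) (pos-* 2 (2 ℕ.* c ℕ.+ 1)) ⟩
  + 2 * + (2 ℕ.* c ℕ.+ 1) - + 2      ≡⟨ cong (λ m → + 2 * m - + 2) (pos-+ (2 ℕ.* c) 1) ⟩
  + 2 * (+ (2 ℕ.* c) + + 1) - + 2    ≡⟨ cong (λ m → + 2 * (m + + 1) - + 2) (pos-* 2 c) ⟩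
  + 2 * (+ 2 * + c + + 1) - + 2      ≡⟨ expand (+ c) ⟩
  + c * + 4                          ∎)
  where
  open ≡-Reasoning
  expand : ∀ c → + 2 * (+ 2 * c + + 1) - + 2 ≡ c * + 4
  expand = solve-∀

L1Odd⇒twiceSum-≡-mod2 : ∀ {n} (p q : Point n) → L1Odd p q → twiceSum p ≡ twiceSum q mod + 2
L1Odd⇒twiceSum-≡-mod2 p q odd = subst (+ 2 ∣_) (regroup (+ twiceL1 p q) (twiceSum p - twiceSum q))
  (∣m∣n⇒∣m+n (∣m∣n⇒∣m-n (∣-trans (divides (+ 2) refl) (L1Odd⇒twiceL1≡2-mod4 p q odd)) (≋⇒twiceL1-≡ (≋-mod1 p q))) ∣-refl)
  where
  regroup : ∀ l s → ((l - + 2) - (l - s)) + + 2 ≡ s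
  regroup = solve-∀

parity : ℤ → Fin 2
parity a = fromℕ< (n%ℕd<d a 2)

parity-≡⇒≡-mod2 : ∀ a b → parity a ≡ parity b → a ≡ b mod + 2
parity-≡⇒≡-mod2 a b eq = %ℕ-≡⇒≡-mod a b 2 (fromℕ<-injective _ _ (n%ℕd<d a 2) (n%ℕd<d b 2) eq)

parities : ∀ {n} → Point n → Fin (2 ^ n)
parities []       = zero
parities (x ∷ xs) = combine (parity (twice x)) (parities xs)

parities-≡⇒≋-mod2 : ∀ {n} (p q : Point n) → parities p ≡ parities q → p ≋ q mod + 2
parities-≡⇒≋-mod2 []       []       _  = []
parities-≡⇒≋-mod2 (x ∷ xs) (y ∷ ys) eq =
  parity-≡⇒≡-mod2 (twice x) (twice y) (combine-injectiveˡ _ (parities xs) _ (parities ys) eq)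
  ∷ parities-≡⇒≋-mod2 xs ys (combine-injectiveʳ (parity (twice x)) _ (parity (twice y)) _ eq)

-- The parity of the first coordinate is left out: an even distance determines it from the rest.
label : ∀ {n} → Point (suc n) → Fin (2 ^ suc n)
label p@(_ ∷ xs) = combine (parity (twiceSum p /ℕ 2)) (parities xs)

label-≡⇒¬L1Odd : ∀ {n} (p q : Point (suc n)) → label p ≡ label q → ¬ L1Odd p q
label-≡⇒¬L1Odd p@(x ∷ xs) q@(y ∷ ys) eq odd =
  4∤2 (subst (+ 4 ∣_) (regroup L S) (∣m∣n⇒∣m+n (∣m∣n⇒∣m-n L≡S (L1Odd⇒twiceL1≡2-mod4 p q odd)) 4∣S))
  where
  β = parity (twiceSum p /ℕ 2)
  β′ = parity (twiceSum q /ℕ 2)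
  L = + twiceL1 p q
  S = twiceSum p - twiceSum q
  tails : xs ≋ ys mod + 2
  tails = parities-≡⇒≋-mod2 xs ys (combine-injectiveʳ β (parities xs) β′ (parities ys) eq)
  heads : twice x ≡ twice y mod + 2
  heads = ≡-mod-+-cancelʳ (twice x) (twice y) (L1Odd⇒twiceSum-≡-mod2 p q odd) (≋⇒twiceSum-≡ tails)
  coordinates : p ≋ q mod + 2
  coordinates = heads ∷ tails
  L≡S : L ≡ S mod + 4
  L≡S = ≋⇒twiceL1-≡ coordinates
  4∣S : + 4 ∣ S
  4∣S = ≡-mod2∧halves⇒≡-mod4 (twiceSum p) (twiceSum q) (≋⇒twiceSum-≡ coordinates)
          (parity-≡⇒≡-mod2 (twiceSum p /ℕ 2) (twiceSum q /ℕ 2) (combine-injectiveˡ β (parities xs) β′ (parities ys) eq))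
  regroup : ∀ l s → (l - s) - (l - + 2) + s ≡ + 2
  regroup = solve-∀
  4∤2 : ¬ (+ 4 ∣ + 2)
  4∤2 4∣2 with ℕ.s≤s (ℕ.s≤s ()) ← ℕ.∣⇒≤ (∣⇒∣ᵤ 4∣2)

proposition1p2 : (n : ℕ) → 1 ≤ n → (m : ℕ) → (P : Fin m → Point n) → Injective _≡_ _≡_ P →
    (∀ i j → ¬ i ≡ j → L1Odd (P i) (P j)) → m ≤ 2 ^ n
proposition1p2 (suc n) _ m P _ odd = injective⇒≤ label∘P-injective
  where
  label∘P-injective : Injective _≡_ _≡_ (λ i → label (P i))
  label∘P-injective {i} {j} eq with i ≟ j
  ... | yes i≡j = i≡j
  ... | no  i≢j = ⊥-elim (label-≡⇒¬L1Odd (P i) (P j) eq (odd i j i≢j))
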